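{- Every equation in the language of $\ell$-pregroups that fails in a diagram also fails in $\mathbf{F}_{\textup{fs}}(\mathbb{Z})$.
   Context: $\mathbf{F}(\mathbb{Z})$ is the distributive $\ell$-pregroup of all order-preserving maps on the chain $\mathbb{Z}$ having residuals and dual residuals of all orders (equivalently, finite-to-one order-preserving maps), under composition, pointwise order, and $f^{\ell}$, $f^{r}$ the dual residual and residual. $\mathbf{F}_{\textup{fs}}(\mathbb{Z})$ is its subalgebra of functions of finite support (equal to the identity except at finitely many points). Write $x^{(0)}=x$, $x^{(m)}=x^{\ell^m}$, $x^{(-m)}=x^{r^m}$ for $m\in\mathbb{Z}^+$. Every equation is equivalent over distributive $\ell$-pregroups to one in intentional form $1\leq w_1\vee\cdots\vee w_k$ over variables $x_1,\ldots,x_n$, each $w_j$ a product of terms $x_i^{(m)}$; failure of an arbitrary equation in a diagram is understood via this form. A c-chain is a triple $(\Delta,\leq,\lessdot)$ with $(\Delta,\leq)$ a finite chain and $\lessdot$ a subset of its covering relation. For an order-preserving partial function $g$ on it: $(x,b)\in g^{[\ell]}$ iff $b\in Dom(g)$ and some $a\in Dom(g)$ has $a\lessdot b$ and $g(a)<x\leq g(b)$; $(x,a)\in g^{[r]}$ iff $a\in Dom(g)$ and some $b\in Dom(g)$ has $a\lessdot b$ and $g(a)\leq x<g(b)$. $\mathbf{Pf}(\mathbf{\Delta})$ is the algebra of order-preserving partial functions under composition, $^{[\ell]}$, $^{[r]}$ and identity. A diagram $(\mathbf{\Delta},f_1,\ldots,f_n)$ is a finite c-chain with order-preserving partial functions $f_1,\ldots,f_n$;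 the equation $1\leq w_1\vee\cdots\vee w_k$ fails in it if there is a homomorphism $\psi$ from intentional terms (multiplication, $1$, iterated inverses) to $\mathbf{Pf}(\mathbf{\Delta})$ with $\psi(x_i)=f_i$ and a point $p\in\Delta$ with $\psi(1)(p)>\psi(w_j)(p)$ for all $j$. -}

module Defs where

open import Data.Nat as ℕ using (ℕ; zero)
open import Data.Integer as ℤ using (ℤ; +_; -[1+_])
open import Data.Fin as Fin using (Fin; toℕ)
open import Data.Maybe using (Maybe; just)
open import Data.List using (List; []; _∷_)
open import Data.List.NonEmpty using (List⁺)
open import Data.List.Membership.Propositional using (_∉_)
open import Data.List.Relation.Unary.All using (All)
open import Data.Product using (Σ; ∃; ∃-syntax; _×_; _,_)
open import Function using (_⇔_)
open import Relation.Binary.PropositionalEquality using (_≡_)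

-- Intentional equations  1 ≤ w₁ ∨ ⋯ ∨ wₖ  over variables x₀,…,x_{n-1}.
-- A literal (i , m) stands for x_i^{(m)}  (m > 0: x^{ℓ^m}, m < 0: x^{r^{|m|}}).
-- A word is the product of its literals, read left to right:
-- (i₁,m₁) ∷ (i₂,m₂) ∷ … stands for x_{i₁}^{(m₁)} x_{i₂}^{(m₂)} ⋯ .

Literal : ℕ → Set
Literal n = Fin n × ℤ

Word : ℕ → Set
Word n = List (Literal n)

IntentionalEq : ℕ → Set
IntentionalEq n = List⁺ (Word n)

OrderPreserving : (ℤ → ℤ) → Set
OrderPreserving f = ∀ x y → x ℤ.≤ y → f x ℤ.≤ f y

FiniteSupport : (ℤ → ℤ) → Set
FiniteSupport f = ∃[ L ] (∀ x → x ∉ L → f x ≡ x)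

IsDualResidual : (ℤ → ℤ) → (ℤ → ℤ) → Set
IsDualResidual f g = ∀ x y → (y ℤ.≤ f x) ⇔ (g y ℤ.≤ x)

-- F m = f^{(m)} for all m ∈ ℤ: F 0 = f and F (m+1) = (F m)^ℓ,
-- equivalently F (m-1) = (F m)^r.  (Such a chain exists iff f has
-- residuals and dual residuals of all orders, and is then unique.)
IsInverseChain : (ℤ → ℤ) → (ℤ → ℤ → ℤ) → Set
IsInverseChain f F = (∀ x → F (+ 0) x ≡ f x)
                   × (∀ m → IsDualResidual (F m) (F (ℤ.suc m)))

InFfs : (ℤ → ℤ) → Set
InFfs f = OrderPreserving f × FiniteSupport f
        × ∃[ F ] IsInverseChain f F

evalℤ : ∀ {n} → (Fin n → ℤ → ℤ → ℤ) → Word n → ℤ → ℤ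
evalℤ F []            x = x
evalℤ F ((i , m) ∷ w) x = F i m (evalℤ F w x)

FailsInFfs : ∀ {n} → IntentionalEq n → Set
FailsInFfs {n} ws =
  Σ (Fin n → ℤ → ℤ) λ f → (∀ i → InFfs (f i)) ×
  Σ (Fin n → ℤ → ℤ → ℤ) λ F → (∀ i → IsInverseChain (f i) (F i)) ×
  ∃[ p ] All (λ w → evalℤ F w p ℤ.< p) (Data.List.NonEmpty.toList ws)

-- A finite chain is (up to isomorphism) Fin d with its
-- natural order; ⋖ is a subset of the covering relation.
-- Partial functions on Fin d are represented by their graphs:
-- g x y  means  "x ∈ Dom g and g(x) = y".

PRel : ℕ → Set₁
PRel d = Fin d → Fin d → Set

record CChain : Set₁ where
  field
    size    : ℕ
    cov     : Fin size → Fin size → Set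
    cov-sub : ∀ a b → cov a b → toℕ b ≡ ℕ.suc (toℕ a)

module _ (Δ : CChain) where
  open CChain Δ

  lres : PRel size → PRel size
  lres g x b = ∃[ a ] ∃[ ga ] ∃[ gb ]
    (cov a b × g a ga × g b gb × ga Fin.< x × x Fin.≤ gb)

  rres : PRel size → PRel size
  rres g x a = ∃[ b ] ∃[ ga ] ∃[ gb ]
    (cov a b × g a ga × g b gb × ga Fin.≤ x × x Fin.< gb)

  iter : (PRel size → PRel size) → ℕ → PRel size → PRel size
  iter h zero      g = g
  iter h (ℕ.suc k) g = h (iter h k g)

  inv : ℤ → PRel size → PRel size
  inv (+ k)      g = iter lres k g
  inv -[1+ k ]   g = iter rres (ℕ.suc k) g

  graph : (Fin size → Maybe (Fin size)) → PRel size
  graph f x y = f x ≡ just y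

  -- ψ(w) for a word w (composition: (gh)(x) = g(h(x)))
  evalΔ : ∀ {n} → (Fin n → Fin size → Maybe (Fin size)) → Word n → PRel size
  evalΔ f []            x z = x ≡ z
  evalΔ f ((i , m) ∷ w) x z = ∃[ y ] (evalΔ f w x y × inv m (graph (f i)) y z)

  OrderPreservingP : (Fin size → Maybe (Fin size)) → Set
  OrderPreservingP f = ∀ a b fa fb → a Fin.≤ b → f a ≡ just fa → f b ≡ just fb
                       → fa Fin.≤ fb

record Diagram (n : ℕ) : Set₁ where
  field
    chain : CChain
    fun   : Fin n → Fin (CChain.size chain) → Maybe (Fin (CChain.size chain))
    mono  : ∀ i → OrderPreservingP chain (fun i)

FailsInDiagram : ∀ {n} → Diagram n → IntentionalEq n → Set
FailsInDiagram D ws = ∃[ p ] All (λ w → ∃[ q ] (evalΔ chain fun w p q × q Fin.< p))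
                                  (Data.List.NonEmpty.toList ws)
  where open Diagram D

{-# OPTIONS --safe #-}
-- Place the chain of the diagram at 0, …, d-1 in ℤ and extend each partial map
-- to a total order-preserving map of ℤ that repeats the last defined value
-- across gaps and is the identity outside [0, d).  A map that fixes every point
-- outside a bounded interval has a dual residual y ↦ min {x | y ≤ f x}, which
-- again fixes every point outside a slightly wider interval; conjugating by
-- negation gives the residual.  Iterating yields all f^(m) inside F_fs(ℤ).
-- Adjointness forces f^ℓ(x) = a+1 whenever f(a) < x ≤ f(a+1), and f^r(x) = a
-- whenever f(a) ≤ x < f(a+1), which is exactly how the diagram computes g^[ℓ]
-- and g^[r] along a ⋖ a+1.  So every ψ(w)(p) defined in the diagram equals the
-- value of w at p in F_fs(ℤ), and a failing point of the diagram fails there.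
module Submission where

open import Defs
open import Data.Nat as ℕ using (ℕ; zero; suc; _≤′_; ≤′-refl; ≤′-step)
import Data.Nat.Properties as ℕP
open import Data.Nat.GeneralisedArithmetic using (fold)
open import Data.Integer as ℤ
  using (ℤ; +_; -[1+_]; _≤_; _<_; -_; _+_; +≤+; -≤+; -≤-; +<+)
import Data.Integer.Properties as ℤP
open import Data.Fin as Fin using (Fin; toℕ; fromℕ<)
import Data.Fin.Properties as FinP
open import Data.Maybe as Maybe using (Maybe; just; nothing; fromMaybe)
open import Data.List using ([]; _∷_; map; upTo)
open import Data.List.Membership.Propositional using (_∉_)
open import Data.List.Membership.Propositional.Properties using (∈-map⁺; ∈-upTo⁺)
import Data.List.Relation.Unary.All as All
open import Data.Product using (∃-syntax; _×_; _,_; proj₁; proj₂)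
open import Data.Sum using (_⊎_; inj₁; inj₂)
open import Function using (_∘_; _⇔_; mk⇔; Equivalence)
open import Relation.Nullary using (¬_; yes; no; contradiction)
open import Relation.Unary using (Pred; Decidable)
open import Relation.Binary.PropositionalEquality

private
  variable
    k d : ℕ
    a x y : ℤ
    G H H′ : ℤ → ℤ

UpwardClosed : Pred ℤ _ → Set
UpwardClosed P = ∀ {x y} → x ≤ y → P x → P y

NoneBelow : Pred ℤ _ → ℤ → Set
NoneBelow P s = ∀ x → x < s → ¬ P x

least-upwardClosed : (P : Pred ℤ _) → Decidable P → UpwardClosed P →
  ∀ n s → NoneBelow P s → P (s + + n) → ∃[ r ] (P r × NoneBelow P r)
least-upwardClosed P P? up zero s none Ps+0 = s , subst P (ℤP.+-identityʳ s) Ps+0 , none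
least-upwardClosed P P? up (suc n) s none Ps+n with P? s
... | yes Ps = s , Ps , none
... | no ¬Ps = least-upwardClosed P P? up n (ℤ.suc s) none′ (subst P shift Ps+n)
  where
  none′ : NoneBelow P (ℤ.suc s)
  none′ x x<1+s Px = ¬Ps (up (subst (x ≤_) (ℤP.pred-suc s) (ℤP.i<j⇒i≤pred[j] x<1+s)) Px)
  shift : s + + suc n ≡ ℤ.suc s + + n
  shift = trans (sym (ℤP.+-assoc s (+ 1) (+ n))) (cong (_+ + n) (ℤP.+-comm s (+ 1)))

Outside : ℕ → ℤ → Set
Outside k x = x < - + k ⊎ + k < x

FixedOutside : ℕ → (ℤ → ℤ) → Set
FixedOutside k G = ∀ x → Outside k x → G x ≡ x

-suc≤- : ∀ k → - + suc k ≤ - + k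
-suc≤- k = ℤP.neg-mono-≤ (+≤+ (ℕP.n≤1+n k))

outside-suc : Outside (suc k) x → Outside k x
outside-suc {k} (inj₁ x<-1-k) = inj₁ (ℤP.<-≤-trans x<-1-k (-suc≤- k))
outside-suc {k} (inj₂ 1+k<x)  = inj₂ (ℤP.<-trans (+<+ (ℕP.n<1+n k)) 1+k<x)

pred<self : ∀ x → ℤ.pred x < x
pred<self x = ℤP.i≤pred[j]⇒i<j ℤP.≤-refl

outside-pred : Outside (suc k) x → Outside k (ℤ.pred x)
outside-pred {k} {x} (inj₁ x<-1-k) = inj₁ (ℤP.<-trans (pred<self x) (ℤP.<-≤-trans x<-1-k (-suc≤- k)))
outside-pred {k}     (inj₂ 1+k<x)  = inj₂ (ℤP.<-≤-trans (+<+ (ℕP.n<1+n k)) (ℤP.i<j⇒i≤pred[j] 1+k<x))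

outside-neg : Outside k x → Outside k (- x)
outside-neg {k} (inj₁ x<-k) = inj₂ (subst (_< - _) (ℤP.neg-involutive (+ k)) (ℤP.neg-mono-< x<-k))
outside-neg     (inj₂ k<x)  = inj₁ (ℤP.neg-mono-< k<x)

module _ (dr : IsDualResidual G H) where

  dualResidual-mono : OrderPreserving H
  dualResidual-mono y₁ y₂ y₁≤y₂ =
    Equivalence.to (dr (H y₂) y₁) (ℤP.≤-trans y₁≤y₂ (Equivalence.from (dr (H y₂) y₂) ℤP.≤-refl))

  dualResidual-fixedOutside : FixedOutside k G → FixedOutside (suc k) H
  dualResidual-fixedOutside {k} fixed y o = ℤP.≤-antisym Hy≤y y≤Hy
    where
    Hy≤y : H y ≤ y
    Hy≤y = Equivalence.to (dr y y) (ℤP.≤-reflexive (sym (fixed y (outside-suc o))))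
    y≤Hy : y ≤ H y
    y≤Hy = ℤP.≮⇒≥ λ Hy<y → ℤP.<⇒≱ (pred<self y)
      (subst (y ≤_) (fixed (ℤ.pred y) (outside-pred o))
        (Equivalence.from (dr (ℤ.pred y) y) (ℤP.i<j⇒i≤pred[j] Hy<y)))

  dualResidual-between : G a < x → x ≤ G (ℤ.suc a) → H x ≡ ℤ.suc a
  dualResidual-between {a} {x} Ga<x x≤G[1+a] = ℤP.≤-antisym
    (Equivalence.to (dr (ℤ.suc a) x) x≤G[1+a])
    (ℤP.≮⇒≥ λ Hx<1+a → ℤP.<⇒≱ Ga<x
      (Equivalence.from (dr a x) (subst (H x ≤_) (ℤP.pred-suc a) (ℤP.i<j⇒i≤pred[j] Hx<1+a))))

  residual-between : H a ≤ x → x < H (ℤ.suc a) → G x ≡ a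
  residual-between {a} {x} Ha≤x x<H[1+a] = ℤP.≤-antisym
    (ℤP.≮⇒≥ λ a<Gx → ℤP.<⇒≱ x<H[1+a] (Equivalence.to (dr x (ℤ.suc a)) (ℤP.i<j⇒suc[i]≤j a<Gx)))
    (Equivalence.from (dr x a) Ha≤x)

∣i∣-bounds : ∀ i → - + ℤ.∣ i ∣ ≤ i × i ≤ + ℤ.∣ i ∣
∣i∣-bounds (+ n)    = ℤP.neg-≤-pos , ℤP.≤-refl
∣i∣-bounds -[1+ n ] = ℤP.≤-refl , -≤+

module _ (mono : OrderPreserving G) (fixed : FixedOutside k G) where

  leastPreimageAbove : ∀ y → ∃[ r ] (y ≤ G r × NoneBelow (λ x → y ≤ G x) r)
  leastPreimageAbove y =
    least-upwardClosed P (λ x → y ℤP.≤? G x) (λ x≤z y≤Gx → ℤP.≤-trans y≤Gx (mono _ _ x≤z))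
      (m ℕ.+ m) (- + m) none (subst P (sym top) P[m])
    where
    P : Pred ℤ _
    P x = y ≤ G x
    m = suc (k ℕ.+ ℤ.∣ y ∣)
    k<m : k ℕ.< m
    k<m = ℕ.s≤s (ℕP.m≤m+n k _)
    ∣y∣≤m : ℤ.∣ y ∣ ℕ.≤ m
    ∣y∣≤m = ℕP.m≤n⇒m≤1+n (ℕP.m≤n+m _ k)
    -m≤y : - + m ≤ y
    -m≤y = ℤP.≤-trans (ℤP.neg-mono-≤ (+≤+ ∣y∣≤m)) (proj₁ (∣i∣-bounds y))
    none : NoneBelow P (- + m)
    none x x<-m y≤Gx = ℤP.<⇒≱ (ℤP.<-≤-trans x<-m -m≤y)
      (subst (y ≤_) (fixed x (inj₁ (ℤP.<-≤-trans x<-m (ℤP.neg-mono-≤ (+≤+ (ℕP.<⇒≤ k<m)))))) y≤Gx)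
    P[m] : P (+ m)
    P[m] = subst (y ≤_) (sym (fixed (+ m) (inj₂ (+<+ k<m))))
      (ℤP.≤-trans (proj₂ (∣i∣-bounds y)) (+≤+ ∣y∣≤m))
    top : - + m + + (m ℕ.+ m) ≡ + m
    top = begin
      - + m + (+ m + + m)   ≡⟨ ℤP.+-assoc (- + m) (+ m) (+ m) ⟨
      (- + m + + m) + + m   ≡⟨ cong (_+ + m) (ℤP.+-inverseˡ (+ m)) ⟩
      + m                   ∎
      where open ≡-Reasoning

  dualResidual : ℤ → ℤ
  dualResidual y = proj₁ (leastPreimageAbove y)

  isDualResidual-dualResidual : IsDualResidual G dualResidual
  isDualResidual-dualResidual x y = mk⇔
    (λ y≤Gx → ℤP.≮⇒≥ λ x<r → proj₂ (proj₂ (leastPreimageAbove y)) x x<r y≤Gx)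
    (λ r≤x → ℤP.≤-trans (proj₁ (proj₂ (leastPreimageAbove y))) (mono _ _ r≤x))

conj : (ℤ → ℤ) → ℤ → ℤ
conj G x = - G (- x)

conj-involutive : ∀ G x → conj (conj G) x ≡ G x
conj-involutive G x = trans (ℤP.neg-involutive _) (cong G (ℤP.neg-involutive x))

conj-mono : OrderPreserving G → OrderPreserving (conj G)
conj-mono mono x y x≤y = ℤP.neg-mono-≤ (mono _ _ (ℤP.neg-mono-≤ x≤y))

conj-fixedOutside : FixedOutside k G → FixedOutside k (conj G)
conj-fixedOutside fixed x o = trans (cong -_ (fixed (- x) (outside-neg o))) (ℤP.neg-involutive x)

neg-≤-swap : ∀ {x y} → x ≤ - y → y ≤ - x
neg-≤-swap {x} {y} x≤-y = subst (_≤ - x) (ℤP.neg-involutive y) (ℤP.neg-mono-≤ x≤-y)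

neg-≤-swap′ : ∀ {x y} → - x ≤ y → - y ≤ x
neg-≤-swap′ {x} {y} -x≤y = subst (- y ≤_) (ℤP.neg-involutive x) (ℤP.neg-mono-≤ -x≤y)

conj-isDualResidual : IsDualResidual G H → IsDualResidual (conj H) (conj G)
conj-isDualResidual dr x y = mk⇔
  (λ y≤-H[-x] → neg-≤-swap′ (Equivalence.from (dr (- y) (- x)) (neg-≤-swap y≤-H[-x])))
  (λ -G[-y]≤x → neg-≤-swap (Equivalence.to (dr (- y) (- x)) (neg-≤-swap′ -G[-y]≤x)))

isDualResidual-resp : IsDualResidual G H → (∀ y → H y ≡ H′ y) → IsDualResidual G H′
isDualResidual-resp dr H≗H′ x y = subst (λ z → (y ≤ _) ⇔ (z ≤ x)) (H≗H′ y) (dr x y)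

record TameMap : Set where
  constructor tame
  field
    radius : ℕ
    fun    : ℤ → ℤ
    mono   : OrderPreserving fun
    fixed  : FixedOutside radius fun

open TameMap using (fun)

conjᵀ : TameMap → TameMap
conjᵀ (tame k G mono fixed) = tame k (conj G) (conj-mono mono) (conj-fixedOutside fixed)

dualResidualᵀ : TameMap → TameMap
dualResidualᵀ (tame k G mono fixed) = tame (suc k) (dualResidual mono fixed)
  (dualResidual-mono dr) (dualResidual-fixedOutside dr fixed)
  where dr = isDualResidual-dualResidual mono fixed

residualᵀ : TameMap → TameMap
residualᵀ T = conjᵀ (dualResidualᵀ (conjᵀ T))

dualResidualᵀ-isDualResidual : ∀ T → IsDualResidual (fun T) (fun (dualResidualᵀ T))
dualResidualᵀ-isDualResidual (tame k G mono fixed) = isDualResidual-dualResidual mono fixed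

residualᵀ-isDualResidual : ∀ T → IsDualResidual (fun (residualᵀ T)) (fun T)
residualᵀ-isDualResidual T = isDualResidual-resp
  (conj-isDualResidual (dualResidualᵀ-isDualResidual (conjᵀ T)))
  (conj-involutive (fun T))

inverseChain : TameMap → ℤ → ℤ → ℤ
inverseChain T (+ n)    = fun (fold T dualResidualᵀ n)
inverseChain T -[1+ n ] = fun (fold T residualᵀ (suc n))

inverseChain-isInverseChain : ∀ T → IsInverseChain (fun T) (inverseChain T)
inverseChain-isInverseChain T = (λ _ → refl) , adjacent
  where
  adjacent : ∀ m → IsDualResidual (inverseChain T m) (inverseChain T (ℤ.suc m))
  adjacent (+ n)        = dualResidualᵀ-isDualResidual (fold T dualResidualᵀ n)
  adjacent -[1+ zero ]  = residualᵀ-isDualResidual T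
  adjacent -[1+ suc n ] = residualᵀ-isDualResidual (fold T residualᵀ (suc n))

tame-inFfs : ∀ T → FiniteSupport (fun T) → InFfs (fun T)
tame-inFfs T finite = TameMap.mono T , finite , inverseChain T , inverseChain-isInverseChain T

module Completion (p : ℕ → Maybe ℕ)
  (p-mono : ∀ {a b va vb} → a ℕ.≤ b → p a ≡ just va → p b ≡ just vb → va ℕ.≤ vb) where

  complete : ℕ → ℕ
  complete zero    = fromMaybe 0 (p zero)
  complete (suc n) = fromMaybe (complete n) (p (suc n))

  complete-extends : ∀ {n v} → p n ≡ just v → complete n ≡ v
  complete-extends {zero}  eq rewrite eq = refl
  complete-extends {suc n} eq rewrite eq = refl

  complete-attained : ∀ n → complete n ≡ 0 ⊎ ∃[ a ] (a ℕ.≤ n × p a ≡ just (complete n))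
  complete-attained zero with p zero in eq
  ... | just _  = inj₂ (0 , ℕ.z≤n , eq)
  ... | nothing = inj₁ refl
  complete-attained (suc n) with p (suc n) in eq
  ... | just _  = inj₂ (suc n , ℕP.≤-refl , eq)
  ... | nothing with complete-attained n
  ...   | inj₁ c≡0               = inj₁ c≡0
  ...   | inj₂ (a , a≤n , pa≡c) = inj₂ (a , ℕP.m≤n⇒m≤1+n a≤n , pa≡c)

  complete-step : ∀ n → complete n ℕ.≤ complete (suc n)
  complete-step n with p (suc n) in eq
  ... | nothing = ℕP.≤-refl
  ... | just v with complete-attained n
  ...   | inj₁ c≡0               = subst (ℕ._≤ v) (sym c≡0) ℕ.z≤n
  ...   | inj₂ (a , a≤n , pa≡c) = p-mono (ℕP.m≤n⇒m≤1+n a≤n) pa≡c eq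

  complete-mono′ : ∀ {a b} → a ≤′ b → complete a ℕ.≤ complete b
  complete-mono′ ≤′-refl          = ℕP.≤-refl
  complete-mono′ (≤′-step {n} a≤′n) = ℕP.≤-trans (complete-mono′ a≤′n) (complete-step n)

  complete-mono : ∀ {a b} → a ℕ.≤ b → complete a ℕ.≤ complete b
  complete-mono a≤b = complete-mono′ (ℕP.≤⇒≤′ a≤b)

extendℤ : (ℕ → ℕ) → ℤ → ℤ
extendℤ g (+ n)    = + g n
extendℤ g -[1+ n ] = -[1+ n ]

module _ {g : ℕ → ℕ} where

  extendℤ-mono : (∀ {a b} → a ℕ.≤ b → g a ℕ.≤ g b) → OrderPreserving (extendℤ g)
  extendℤ-mono g-mono _ _ (-≤- n≤m) = -≤- n≤m
  extendℤ-mono g-mono _ _ -≤+       = -≤+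
  extendℤ-mono g-mono _ _ (+≤+ m≤n) = +≤+ (g-mono m≤n)

  module _ (g-fixed : ∀ n → d ℕ.≤ n → g n ≡ n) where

    extendℤ-fixedOutside : FixedOutside d (extendℤ g)
    extendℤ-fixedOutside -[1+ n ] _               = refl
    extendℤ-fixedOutside (+ n)    (inj₁ n<-d)     = contradiction (ℤP.<-≤-trans n<-d ℤP.neg-≤-pos) (ℤP.<-irrefl refl)
    extendℤ-fixedOutside (+ n)    (inj₂ (+<+ d<n)) = cong +_ (g-fixed n (ℕP.<⇒≤ d<n))

    extendℤ-finiteSupport : FiniteSupport (extendℤ g)
    extendℤ-finiteSupport = map +_ (upTo d) , fixed
      where
      fixed : ∀ x → x ∉ map +_ (upTo d) → extendℤ g x ≡ x
      fixed -[1+ n ] _ = refl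
      fixed (+ n) n∉ with n ℕ.<? d
      ... | yes n<d = contradiction (∈-map⁺ +_ (∈-upTo⁺ n<d)) n∉
      ... | no  n≮d = cong +_ (g-fixed n (ℕP.≮⇒≥ n≮d))

module Extension {d} (f : Fin d → Maybe (Fin d))
  (f-mono : ∀ a b fa fb → a Fin.≤ b → f a ≡ just fa → f b ≡ just fb → fa Fin.≤ fb) where

  onℕ : ℕ → Maybe ℕ
  onℕ n with n ℕ.<? d
  ... | yes n<d = Maybe.map toℕ (f (fromℕ< n<d))
  ... | no _    = just n

  onℕ-beyond : ∀ {n} → d ℕ.≤ n → onℕ n ≡ just n
  onℕ-beyond {n} d≤n with n ℕ.<? d
  ... | yes n<d = contradiction d≤n (ℕP.<⇒≱ n<d)
  ... | no _    = refl

  onℕ-toℕ : ∀ {y z} → f y ≡ just z → onℕ (toℕ y) ≡ just (toℕ z)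
  onℕ-toℕ {y} fy≡z with toℕ y ℕ.<? d
  ... | yes y<d rewrite FinP.fromℕ<-toℕ y y<d | fy≡z = refl
  ... | no  y≮d = contradiction (FinP.toℕ<n y) y≮d

  onℕ-mono : ∀ {a b va vb} → a ℕ.≤ b → onℕ a ≡ just va → onℕ b ≡ just vb → va ℕ.≤ vb
  onℕ-mono {a} {b} a≤b ea eb with a ℕ.<? d | b ℕ.<? d
  ... | yes a<d | yes b<d with f (fromℕ< a<d) in fa | f (fromℕ< b<d) in fb
  ...   | just x | just y with refl ← ea | refl ← eb =
    f-mono _ _ x y (subst₂ ℕ._≤_ (sym (FinP.toℕ-fromℕ< a<d)) (sym (FinP.toℕ-fromℕ< b<d)) a≤b) fa fb
  onℕ-mono a≤b ea refl | yes a<d | no b≮d with f (fromℕ< a<d)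
  ...   | just x with refl ← ea = ℕP.<⇒≤ (ℕP.<-≤-trans (FinP.toℕ<n x) (ℕP.≮⇒≥ b≮d))
  onℕ-mono a≤b ea eb | no a≮d | yes b<d = contradiction (ℕP.≤-<-trans a≤b b<d) a≮d
  onℕ-mono a≤b refl refl | no _ | no _ = a≤b

  open Completion onℕ onℕ-mono

  complete-beyond : ∀ n → d ℕ.≤ n → complete n ≡ n
  complete-beyond n d≤n = complete-extends (onℕ-beyond d≤n)

  extension : TameMap
  extension = tame d (extendℤ complete) (extendℤ-mono complete-mono) (extendℤ-fixedOutside complete-beyond)

  extension-inFfs : InFfs (fun extension)
  extension-inFfs = tame-inFfs extension (extendℤ-finiteSupport complete-beyond)

  extension-extends : ∀ {y z} → f y ≡ just z → fun extension (+ toℕ y) ≡ + toℕ z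
  extension-extends fy≡z = cong +_ (complete-extends (onℕ-toℕ fy≡z))

module _ (Δ : CChain) where
  open CChain Δ

  embed : Fin size → ℤ
  embed a = + toℕ a

  embed-cov : ∀ {a b} → cov a b → embed b ≡ ℤ.suc (embed a)
  embed-cov {a} {b} a⋖b = cong +_ (cov-sub a b a⋖b)

  Realises : PRel size → (ℤ → ℤ) → Set
  Realises g G = ∀ {y z} → g y z → G (embed y) ≡ embed z

  module _ {g : PRel size} (g⊆G : Realises g G) where

    lres-realised : IsDualResidual G H → Realises (lres Δ g) H
    lres-realised dr (a , ga , gb , a⋖b , pa , pb , ga<x , x≤gb) rewrite embed-cov a⋖b =
      dualResidual-between dr (subst (_< _) (sym (g⊆G pa)) (+<+ ga<x))
        (subst (_ ≤_) (trans (sym (g⊆G pb)) (cong G (embed-cov a⋖b))) (+≤+ x≤gb))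

    rres-realised : IsDualResidual H G → Realises (rres Δ g) H
    rres-realised dr (b , ga , gb , a⋖b , pa , pb , ga≤x , x<gb) =
      residual-between dr (subst (_≤ _) (sym (g⊆G pa)) (+≤+ ga≤x))
        (subst (_ <_) (trans (sym (g⊆G pb)) (cong G (embed-cov a⋖b))) (+<+ x<gb))

  module _ {g : PRel size} {G} {F : ℤ → ℤ → ℤ} (chain : IsInverseChain G F) (g⊆G : Realises g G) where

    g⊆F₀ : Realises g (F (+ 0))
    g⊆F₀ gyz = trans (proj₁ chain _) (g⊆G gyz)

    iter-lres-realised : ∀ n → Realises (iter Δ (lres Δ) n g) (F (+ n))
    iter-lres-realised zero    = g⊆F₀
    iter-lres-realised (suc n) = lres-realised (iter-lres-realised n) (proj₂ chain (+ n))

    iter-rres-realised : ∀ n → Realises (iter Δ (rres Δ) (suc n) g) (F -[1+ n ])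
    iter-rres-realised zero    = rres-realised g⊆F₀ (proj₂ chain -[1+ 0 ])
    iter-rres-realised (suc n) = rres-realised (iter-rres-realised n) (proj₂ chain -[1+ suc n ])

    inv-realised : ∀ m → Realises (inv Δ m g) (F m)
    inv-realised (+ n)    = iter-lres-realised n
    inv-realised -[1+ n ] = iter-rres-realised n

  evalΔ-realised : ∀ {n} {f : Fin n → Fin size → Maybe (Fin size)} {F : Fin n → ℤ → ℤ → ℤ} →
    (∀ i m → Realises (inv Δ m (graph Δ (f i))) (F i m)) → ∀ w → Realises (evalΔ Δ f w) (evalℤ F w)
  evalΔ-realised inv⊆F []            refl            = refl
  evalΔ-realised {F = F} inv⊆F ((i , m) ∷ w) (y , wxy , iyz) =
    trans (cong (F i m) (evalΔ-realised inv⊆F w wxy)) (inv⊆F i m iyz)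

theorem4p1 : (n : ℕ) (ws : IntentionalEq n) (D : Diagram n) →
    FailsInDiagram D ws → FailsInFfs ws
theorem4p1 n ws D (p , fails) =
  fun ∘ E.extension , E.extension-inFfs , F , isInverseChain-F , embed Δ p ,
  All.map (λ { {w} (q , pwq , q<p) →
    subst (_< embed Δ p) (sym (evalΔ-realised Δ inv⊆F w pwq)) (+<+ q<p) }) fails
  where
  Δ = Diagram.chain D
  module E i = Extension (Diagram.fun D i) (Diagram.mono D i)
  F : Fin n → ℤ → ℤ → ℤ
  F i = inverseChain (E.extension i)
  isInverseChain-F : ∀ i → IsInverseChain (fun (E.extension i)) (F i)
  isInverseChain-F i = inverseChain-isInverseChain (E.extension i)
  inv⊆F : ∀ i m → Realises Δ (inv Δ m (graph Δ (Diagram.fun D i))) (F i m)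
  inv⊆F i = inv-realised Δ (isInverseChain-F i) (E.extension-extends i)
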